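{- Let $p<q$ be positive integers with $q-p$ even, let $b=\frac{q-p}{2}$, and assume $p\ge 2b$. Then the sets $\{p+1,\dots,p+b\}$ and $\{p+b+1,\dots,q\}$ are both consistent with respect to the control sequence for $(p,q)$.
   Context: The control sequence for $(p,q)$ is the infinite sequence of brackets $\beta_1,\beta_2,\dots$, where $\beta_j\subseteq\{1,\dots,q\}$ consists of the numbers $(j-1)b+1,\dots,(j-1)b+p$, each reduced modulo $q$ into $\{1,\dots,q\}$. For $x\in\beta_j$, its occurrence number in bracket $j$ is $|\{j'\le j:x\in\beta_{j'}\}|$. Numbers $x,y$ are in contradiction in bracket $j$ if $x,y\in\beta_j$ and the occurrence number of $y$ in bracket $j$ equals that of $x$ plus $2$. A subset of $\{1,\dots,q\}$ is consistent if no two of its elements are in contradiction in any bracket. -}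

module Defs where

open import Data.Nat using (ℕ; zero; suc; _+_; _*_; _∸_; _≤_; _<_; _≡ᵇ_; NonZero)
open import Data.Nat.DivMod using (_%_)
open import Data.Bool using (Bool; true; false; if_then_else_)
open import Data.List using (List; upTo)
open import Data.Bool.ListAction using (any)
open import Data.Product using (_×_)
open import Relation.Binary.PropositionalEquality using (_≡_)
open import Relation.Nullary using (¬_)

red : (q : ℕ) → .{{NonZero q}} → ℕ → ℕ
red q n = suc ((n ∸ 1) % q)

-- Bracket β_j (j ≥ 1) for parameters p, q, b consists of the numbers
-- (j-1)b+1, …, (j-1)b+p reduced mod q into {1,…,q}.
-- inBracket p q b j x = true  iff  x ∈ β_j.
inBracket : (p q b : ℕ) → .{{NonZero q}} → ℕ → ℕ → Bool
inBracket p q b j x = any (λ i → red q ((j ∸ 1) * b + suc i) ≡ᵇ x) (upTo p)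

occ : (p q b : ℕ) → .{{NonZero q}} → ℕ → ℕ → ℕ
occ p q b zero    x = 0
occ p q b (suc j) x = occ p q b j x + (if inBracket p q b (suc j) x then 1 else 0)

InContradiction : (p q b : ℕ) → .{{NonZero q}} → ℕ → ℕ → ℕ → Set
InContradiction p q b j x y =
  inBracket p q b j x ≡ true × inBracket p q b j y ≡ true × occ p q b j y ≡ occ p q b j x + 2

Consistent : (p q b : ℕ) → .{{NonZero q}} → (ℕ → Set) → Set
Consistent p q b S =
  ∀ (j x y : ℕ) → 1 ≤ j → S x → S y → ¬ InContradiction p q b j x y

Interval : ℕ → ℕ → ℕ → Set
Interval lo hi x = lo ≤ x × x ≤ hi

-- Write q = p + 2b and, for x = w + 1, offset w = p + (q - x). Then x ∈ β_{n+1} exactly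
-- when (n b + offset w) mod q < p, and passing from n to n + 2 adds 2b = q - p to
-- n b + offset w, so ⌊(n b + offset w) / q⌋ grows by one over two steps precisely when x
-- is missing from β_{n+1}. Telescoping gives occ(j, x) = j + Φ(x, 0) - Φ(x, j) for the
-- potential Φ(x, k) = ⌊((k+1) b + offset w) / q⌋ + ⌊(k b + offset w) / q⌋. Moving x up by
-- d ≤ b changes Φ by at most one, so any two numbers at distance at most b have
-- occurrence counts differing by at most one in every bracket, and can never be in
-- contradiction. This holds for every interval of span b in {1,…,q}; only q = p + 2b is
-- used, not p ≥ 1 or 2b ≤ p.
module Submission where

open import Defs
open import Data.Nat using (ℕ; zero; suc; _+_; _*_; _∸_; _≤_; _<_; z≤n; s≤s; NonZero; _/_; _%_)
open import Data.Nat.Properties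
open import Data.Nat.DivMod
open import Data.Nat.Divisibility using (n∣m*n)
open import Data.Nat.Tactic.RingSolver using (solve-∀)
open import Data.Bool using (true; false; T; if_then_else_)
open import Data.Bool.Properties using (T-≡)
open import Data.List.Membership.Propositional using (find; lose)
open import Data.List.Membership.Propositional.Properties using (∈-upTo⁺; ∈-upTo⁻)
open import Data.List.Relation.Unary.Any.Properties using (any⁺; any⁻)
open import Data.Product using (_×_; _,_; proj₁; proj₂; ∃-syntax)
open import Data.Sum using (inj₁; inj₂)
open import Function.Bundles using (_⇔_; mk⇔; Equivalence)
open import Relation.Binary.PropositionalEquality
open import Relation.Nullary using (¬_; yes; no; contradiction)

[m+kn]/n≡m/n+k : ∀ m k n .{{_ : NonZero n}} → (m + k * n) / n ≡ m / n + k
[m+kn]/n≡m/n+k m k n = trans (+-distrib-/-∣ʳ m (n∣m*n k)) (cong (m / n +_) (m*n/n≡m k n))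

[m+k]/n≡[m%n+k]/n+m/n : ∀ m k n .{{_ : NonZero n}} → (m + k) / n ≡ (m % n + k) / n + m / n
[m+k]/n≡[m%n+k]/n+m/n m k n = begin
  (m + k) / n                       ≡⟨ /-congˡ (cong (_+ k) (m≡m%n+[m/n]*n m n)) ⟩
  (m % n + m / n * n + k) / n       ≡⟨ /-congˡ (swap (m % n) (m / n * n) k) ⟩
  (m % n + k + m / n * n) / n       ≡⟨ [m+kn]/n≡m/n+k (m % n + k) (m / n) n ⟩
  (m % n + k) / n + m / n           ∎
  where
  open ≡-Reasoning
  swap : ∀ x y z → x + y + z ≡ x + z + y
  swap = solve-∀

[m+k]%n≡[m%n+k]%n : ∀ m k n .{{_ : NonZero n}} → (m + k) % n ≡ (m % n + k) % n
[m+k]%n≡[m%n+k]%n m k n = begin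
  (m + k) % n                 ≡⟨ %-distribˡ-+ m k n ⟩
  (m % n + k % n) % n         ≡⟨ cong (λ t → (t + k % n) % n) (m%n%n≡m%n m n) ⟨
  (m % n % n + k % n) % n     ≡⟨ %-distribˡ-+ (m % n) k n ⟨
  (m % n + k) % n             ∎
  where open ≡-Reasoning

[m+n]/o≤1+m/o : ∀ m {n o} .{{_ : NonZero o}} → n ≤ o → (m + n) / o ≤ suc (m / o)
[m+n]/o≤1+m/o m {n} {o} n≤o = begin
  (m + n) / o       ≤⟨ /-monoˡ-≤ o (+-monoʳ-≤ m (≤-trans n≤o (≤-reflexive (sym (*-identityˡ o))))) ⟩
  (m + 1 * o) / o   ≡⟨ [m+kn]/n≡m/n+k m 1 o ⟩
  m / o + 1         ≡⟨ +-comm (m / o) 1 ⟩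
  suc (m / o)       ∎
  where open ≤-Reasoning

module _ (m : ℕ) {n o : ℕ} .{{_ : NonZero n}} where

  m%n<o⇒[m+[n∸o]]/n≡m/n : o ≤ n → m % n < o → (m + (n ∸ o)) / n ≡ m / n
  m%n<o⇒[m+[n∸o]]/n≡m/n o≤n r<o = begin
    (m + (n ∸ o)) / n             ≡⟨ [m+k]/n≡[m%n+k]/n+m/n m (n ∸ o) n ⟩
    (m % n + (n ∸ o)) / n + m / n ≡⟨ cong (_+ m / n) (m<n⇒m/n≡0 no-carry) ⟩
    m / n                         ∎
    where
    open ≡-Reasoning
    no-carry : m % n + (n ∸ o) < n
    no-carry = <-≤-trans (+-monoˡ-< (n ∸ o) r<o) (≤-reflexive (m+[n∸m]≡n o≤n))

  o≤m%n⇒[m+[n∸o]]/n≡1+m/n : o ≤ m % n → (m + (n ∸ o)) / n ≡ suc (m / n)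
  o≤m%n⇒[m+[n∸o]]/n≡1+m/n o≤r = begin
    (m + (n ∸ o)) / n               ≡⟨ [m+k]/n≡[m%n+k]/n+m/n m (n ∸ o) n ⟩
    (r + (n ∸ o)) / n + m / n       ≡⟨ cong (λ t → (t + (n ∸ o)) / n + m / n) (m∸n+n≡m o≤r) ⟨
    (r ∸ o + o + (n ∸ o)) / n + m / n ≡⟨ cong (λ t → t / n + m / n) carry ⟩
    (r ∸ o + 1 * n) / n + m / n     ≡⟨ cong (_+ m / n) ([m+kn]/n≡m/n+k (r ∸ o) 1 n) ⟩
    (r ∸ o) / n + 1 + m / n         ≡⟨ cong (λ t → t + 1 + m / n) (m<n⇒m/n≡0 (≤-<-trans (m∸n≤m r o) (m%n<n m n))) ⟩
    suc (m / n)                     ∎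
    where
    open ≡-Reasoning
    r = m % n
    o≤n : o ≤ n
    o≤n = ≤-trans o≤r (m%n≤n m n)
    carry : r ∸ o + o + (n ∸ o) ≡ r ∸ o + 1 * n
    carry = begin
      r ∸ o + o + (n ∸ o)   ≡⟨ +-assoc (r ∸ o) o (n ∸ o) ⟩
      r ∸ o + (o + (n ∸ o)) ≡⟨ cong (r ∸ o +_) (m+[n∸m]≡n o≤n) ⟩
      r ∸ o + n             ≡⟨ cong (r ∸ o +_) (*-identityˡ n) ⟨
      r ∸ o + 1 * n         ∎

[y+b+d]/q+[y+d]/q≤1+[y+b]/q+y/q : ∀ y {b d q} .{{_ : NonZero q}} → d ≤ b → b + d ≤ q →
  (y + b + d) / q + (y + d) / q ≤ suc ((y + b) / q + y / q)
[y+b+d]/q+[y+d]/q≤1+[y+b]/q+y/q y {b} {d} {q} d≤b b+d≤q with (y + d) / q ≤? y / q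
... | yes D≤Y = +-mono-≤ T≤1+B D≤Y
  where
  T≤1+B : (y + b + d) / q ≤ suc ((y + b) / q)
  T≤1+B = [m+n]/o≤1+m/o (y + b) (≤-trans (m≤n+m d b) b+d≤q)
... | no D≰Y = begin
  (y + b + d) / q + (y + d) / q ≤⟨ +-mono-≤ T≤B D≤1+Y ⟩
  (y + b) / q + suc (y / q)     ≡⟨ +-suc ((y + b) / q) (y / q) ⟩
  suc ((y + b) / q + y / q)     ∎
  where
  open ≤-Reasoning
  D≤B : (y + d) / q ≤ (y + b) / q
  D≤B = /-monoˡ-≤ q (+-monoʳ-≤ y d≤b)
  D≤1+Y : (y + d) / q ≤ suc (y / q)
  D≤1+Y = [m+n]/o≤1+m/o y (≤-trans (m≤n+m d b) b+d≤q)
  T≤B : (y + b + d) / q ≤ (y + b) / q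
  T≤B = begin
    (y + b + d) / q   ≡⟨ /-congˡ (+-assoc y b d) ⟩
    (y + (b + d)) / q ≤⟨ [m+n]/o≤1+m/o y b+d≤q ⟩
    suc (y / q)       ≤⟨ ≰⇒> D≰Y ⟩
    (y + d) / q       ≤⟨ D≤B ⟩
    (y + b) / q       ∎

InWindow : (p q : ℕ) → .{{NonZero q}} → ℕ → ℕ → Set
InWindow p q x w = ∃[ i ] i < p × (x + i) % q ≡ w

inBracket-suc⇔ : ∀ p q b .{{_ : NonZero q}} n w →
  T (inBracket p q b (suc n) (suc w)) ⇔ InWindow p q (n * b) w
inBracket-suc⇔ p q b n w = mk⇔ to from
  where
  shift : ∀ i → (n * b + suc i) ∸ 1 ≡ n * b + i
  shift i = cong (_∸ 1) (+-suc (n * b) i)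
  to : T (inBracket p q b (suc n) (suc w)) → InWindow p q (n * b) w
  to t with i , i∈ , hit ← find (any⁻ _ _ t) =
    i , ∈-upTo⁻ i∈ , trans (%-congˡ (sym (shift i))) (suc-injective (≡ᵇ⇒≡ _ _ hit))
  from : InWindow p q (n * b) w → T (inBracket p q b (suc n) (suc w))
  from (i , i<p , hit) =
    any⁺ _ (lose (∈-upTo⁺ i<p) (≡⇒≡ᵇ _ _ (cong suc (trans (%-congˡ (shift i)) hit))))

module _ (p q : ℕ) .{{_ : NonZero q}} (x w : ℕ) where

  private
    v = q ∸ suc w
    rearrange : ∀ x i j v → x + ((i + suc j) + v) ≡ (x + i) + (suc j + v)
    rearrange = solve-∀

  inWindow⇒%<p : p ≤ q → w < q → InWindow p q x w → (x + (p + v)) % q < p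
  inWindow⇒%<p p≤q w<q (i , i<p , hit) = subst (_< p) (sym remainder) i'<p
    where
    open ≡-Reasoning
    i' = p ∸ suc i
    i'<p : i' < p
    i'<p = ∸-monoʳ-< (s≤s z≤n) i<p
    split : i + suc i' ≡ p
    split = trans (+-suc i i') (m+[n∸m]≡n i<p)
    swap : ∀ w j v → w + (suc j + v) ≡ j + (suc w + v)
    swap = solve-∀
    remainder : (x + (p + v)) % q ≡ i'
    remainder = begin
      (x + (p + v)) % q                 ≡⟨ cong (λ t → (x + (t + v)) % q) split ⟨
      (x + ((i + suc i') + v)) % q      ≡⟨ %-congˡ (rearrange x i i' v) ⟩
      ((x + i) + (suc i' + v)) % q      ≡⟨ [m+k]%n≡[m%n+k]%n (x + i) (suc i' + v) q ⟩
      ((x + i) % q + (suc i' + v)) % q  ≡⟨ cong (λ t → (t + (suc i' + v)) % q) hit ⟩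
      (w + (suc i' + v)) % q            ≡⟨ %-congˡ (swap w i' v) ⟩
      (i' + (suc w + v)) % q            ≡⟨ cong (λ t → (i' + t) % q) (m+[n∸m]≡n w<q) ⟩
      (i' + q) % q                      ≡⟨ [m+n]%n≡m%n i' q ⟩
      i' % q                            ≡⟨ m<n⇒m%n≡m (<-≤-trans i'<p p≤q) ⟩
      i'                                ∎

  %<p⇒inWindow : w < q → (x + (p + v)) % q < p → InWindow p q x w
  %<p⇒inWindow w<q r<p = i , i<p , lands-on-w (m / q) (m≡m%n+[m/n]*n m q)
    where
    m = x + (p + v)
    r = m % q
    i = p ∸ suc r
    split : i + suc r ≡ p
    split = m∸n+n≡m r<p
    i<p : i < p
    i<p = ∸-monoʳ-< (s≤s z≤n) r<p
    swap : ∀ r w v t → r + ((suc w + v) + t) ≡ (w + t) + (suc r + v)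
    swap = solve-∀
    lands-on-w : ∀ Q → m ≡ r + Q * q → (x + i) % q ≡ w
    -- m ≥ p > r, so the quotient is positive.
    lands-on-w zero m≡r = contradiction (≤-trans (m≤m+n p v) (m≤n+m (p + v) x))
                                      (<⇒≱ (subst (_< p) (trans (sym (+-identityʳ r)) (sym m≡r)) r<p))
    lands-on-w (suc Q) m≡r = begin
      (x + i) % q         ≡⟨ %-congˡ (+-cancelʳ-≡ (suc r + v) _ _ cancellable) ⟩
      (w + Q * q) % q     ≡⟨ [m+kn]%n≡m%n w Q q ⟩
      w % q               ≡⟨ m<n⇒m%n≡m w<q ⟩
      w                   ∎
      where
      open ≡-Reasoning
      cancellable : (x + i) + (suc r + v) ≡ (w + Q * q) + (suc r + v)
      cancellable = begin
        (x + i) + (suc r + v)         ≡⟨ rearrange x i r v ⟨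
        x + ((i + suc r) + v)         ≡⟨ cong (λ t → x + (t + v)) split ⟩
        m                             ≡⟨ m≡r ⟩
        r + (q + Q * q)               ≡⟨ cong (λ t → r + (t + Q * q)) (m+[n∸m]≡n w<q) ⟨
        r + ((suc w + v) + Q * q)     ≡⟨ swap r w v (Q * q) ⟩
        (w + Q * q) + (suc r + v)     ∎

within-one : ∀ {j o o' a a' z z'} → o + a ≡ j + z → o' + a' ≡ j + z' →
  a' ≤ a → a ≤ suc a' → z' ≤ z → z ≤ suc z' → o' ≤ suc o × o ≤ suc o'
within-one {j} {o} {o'} {a} {a'} {z} {z'} eq eq' a'≤a a≤1+a' z'≤z z≤1+z' =
    +-cancelʳ-≤ a' o' (suc o) (begin
      o' + a'       ≡⟨ eq' ⟩
      j + z'        ≤⟨ +-monoʳ-≤ j z'≤z ⟩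
      j + z         ≡⟨ eq ⟨
      o + a         ≤⟨ +-monoʳ-≤ o a≤1+a' ⟩
      o + suc a'    ≡⟨ +-suc o a' ⟩
      suc o + a'    ∎)
  , +-cancelʳ-≤ a o (suc o') (begin
      o + a         ≡⟨ eq ⟩
      j + z         ≤⟨ +-monoʳ-≤ j z≤1+z' ⟩
      j + suc z'    ≡⟨ +-suc j z' ⟩
      suc (j + z')  ≡⟨ cong suc eq' ⟨
      suc (o' + a') ≤⟨ s≤s (+-monoʳ-≤ o' a'≤a) ⟩
      suc o' + a    ∎)
  where open ≤-Reasoning

module ControlSequence (p b : ℕ) .{{_ : NonZero (p + 2 * b)}} where

  q : ℕ
  q = p + 2 * b

  offset : ℕ → ℕ
  offset w = p + (q ∸ suc w)

  carries : ℕ → ℕ → ℕ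
  carries w k = (k * b + offset w) / q

  Φ : ℕ → ℕ → ℕ
  Φ w k = carries w (suc k) + carries w k

  ∈β⇔%<p : ∀ n w → w < q → T (inBracket p q b (suc n) (suc w)) ⇔ (n * b + offset w) % q < p
  ∈β⇔%<p n w w<q = mk⇔
    (λ t → inWindow⇒%<p p q (n * b) w (m≤m+n p (2 * b)) w<q (Equivalence.to (inBracket-suc⇔ p q b n w) t))
    (λ r<p → Equivalence.from (inBracket-suc⇔ p q b n w) (%<p⇒inWindow p q (n * b) w w<q r<p))

  carries-+2 : ∀ n w → carries w (2 + n) ≡ ((n * b + offset w) + (q ∸ p)) / q
  carries-+2 n w = /-congˡ (trans (shuffle n b (offset w)) (cong (n * b + offset w +_) (sym (m+n∸m≡n p (2 * b)))))
    where
    shuffle : ∀ n b c → (2 + n) * b + c ≡ (n * b + c) + 2 * b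
    shuffle = solve-∀

  occ-step : ∀ n w → w < q →
    (if inBracket p q b (suc n) (suc w) then 1 else 0) + carries w (2 + n) ≡ 1 + carries w n
  occ-step n w w<q with (n * b + offset w) % q <? p | inBracket p q b (suc n) (suc w) in mem
  ... | yes r<p | true  = cong suc (trans (carries-+2 n w)
                                         (m%n<o⇒[m+[n∸o]]/n≡m/n (n * b + offset w) (m≤m+n p (2 * b)) r<p))
  ... | yes r<p | false = contradiction (Equivalence.from (∈β⇔%<p n w w<q) r<p) (subst T mem)
  ... | no r≮p | true  = contradiction (Equivalence.to (∈β⇔%<p n w w<q) (Equivalence.from T-≡ mem)) r≮p
  ... | no r≮p | false = trans (carries-+2 n w) (o≤m%n⇒[m+[n∸o]]/n≡1+m/n (n * b + offset w) (≮⇒≥ r≮p))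

  occ+Φ≡j+Φ₀ : ∀ j w → w < q → occ p q b j (suc w) + Φ w j ≡ j + Φ w 0
  occ+Φ≡j+Φ₀ zero    w w<q = refl
  occ+Φ≡j+Φ₀ (suc j) w w<q = begin
    (o + δ) + (E₂ + E₁)   ≡⟨ regroup o δ E₂ E₁ ⟩
    o + (δ + E₂) + E₁     ≡⟨ cong (λ t → o + t + E₁) (occ-step j w w<q) ⟩
    o + suc E₀ + E₁       ≡⟨ collect o E₀ E₁ ⟩
    suc (o + (E₁ + E₀))   ≡⟨ cong suc (occ+Φ≡j+Φ₀ j w w<q) ⟩
    suc (j + Φ w 0)       ∎
    where
    open ≡-Reasoning
    o = occ p q b j (suc w)
    δ = if inBracket p q b (suc j) (suc w) then 1 else 0
    E₂ = carries w (2 + j)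
    E₁ = carries w (suc j)
    E₀ = carries w j
    regroup : ∀ o δ e₂ e₁ → (o + δ) + (e₂ + e₁) ≡ o + (δ + e₂) + e₁
    regroup = solve-∀
    collect : ∀ o e₀ e₁ → o + suc e₀ + e₁ ≡ suc (o + (e₁ + e₀))
    collect = solve-∀

  module _ {w w' : ℕ} (w≤w' : w ≤ w') (w'<q : w' < q) where

    private
      d = w' ∸ w

    offset-∸ : offset w ≡ offset w' + d
    offset-∸ = begin
      p + (q ∸ suc w)                 ≡⟨ cong (λ t → p + (t ∸ suc w)) q-split ⟨
      p + ((suc w + (d + v')) ∸ suc w) ≡⟨ cong (p +_) (m+n∸m≡n (suc w) (d + v')) ⟩
      p + (d + v')                    ≡⟨ reorder p d v' ⟩
      p + v' + d                      ∎
      where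
      open ≡-Reasoning
      v' = q ∸ suc w'
      reorder : ∀ p d v → p + (d + v) ≡ p + v + d
      reorder = solve-∀
      q-split : suc w + (d + v') ≡ q
      q-split = begin
        suc w + (d + v')  ≡⟨ +-assoc (suc w) d v' ⟨
        suc (w + d) + v'  ≡⟨ cong (λ t → suc t + v') (m+[n∸m]≡n w≤w') ⟩
        suc w' + v'       ≡⟨ m+[n∸m]≡n w'<q ⟩
        q                 ∎

    carries-antitone : ∀ k → carries w' k ≤ carries w k
    carries-antitone k = /-monoˡ-≤ q (+-monoʳ-≤ (k * b) (≤-trans (m≤m+n (offset w') d) (≤-reflexive (sym offset-∸))))

    Φ-antitone : ∀ k → Φ w' k ≤ Φ w k
    Φ-antitone k = +-mono-≤ (carries-antitone (suc k)) (carries-antitone k)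

    Φ≤1+Φ : w' ≤ w + b → ∀ k → Φ w k ≤ suc (Φ w' k)
    Φ≤1+Φ w'≤w+b k = begin
      Φ w k                         ≡⟨ cong₂ _+_ (/-congˡ (trans (cong (suc k * b +_) offset-∸) (split-high k b (offset w') d)))
                                                (/-congˡ (trans (cong (k * b +_) offset-∸) (sym (+-assoc (k * b) (offset w') d)))) ⟩
      (y + b + d) / q + (y + d) / q ≤⟨ [y+b+d]/q+[y+d]/q≤1+[y+b]/q+y/q y d≤b b+d≤q ⟩
      suc ((y + b) / q + y / q)     ≡⟨ cong (λ t → suc (t / q + y / q)) (split-low k b (offset w')) ⟨
      suc (Φ w' k)                  ∎
      where
      open ≤-Reasoning
      y = k * b + offset w'
      d≤b : d ≤ b
      d≤b = ≤-trans (∸-monoˡ-≤ w w'≤w+b) (≤-reflexive (m+n∸m≡n w b))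
      b+d≤q : b + d ≤ q
      b+d≤q = ≤-trans (+-monoʳ-≤ b (≤-trans d≤b (m≤m+n b 0))) (m≤n+m (2 * b) p)
      split-high : ∀ k b c d → suc k * b + (c + d) ≡ k * b + c + b + d
      split-high = solve-∀
      split-low : ∀ k b c → suc k * b + c ≡ k * b + c + b
      split-low = solve-∀

  occ-within-one : ∀ j {w w'} → w < q → w' < q → w' ≤ w + b → w ≤ w' + b →
    occ p q b j (suc w') ≤ suc (occ p q b j (suc w))
  occ-within-one j {w} {w'} w<q w'<q w'≤w+b w≤w'+b with ≤-total w w'
  ... | inj₁ w≤w' = proj₁ (within-one {j = j} (occ+Φ≡j+Φ₀ j w w<q) (occ+Φ≡j+Φ₀ j w' w'<q)
                      (Φ-antitone w≤w' w'<q j) (Φ≤1+Φ w≤w' w'<q w'≤w+b j)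
                      (Φ-antitone w≤w' w'<q 0) (Φ≤1+Φ w≤w' w'<q w'≤w+b 0))
  ... | inj₂ w'≤w = proj₂ (within-one {j = j} (occ+Φ≡j+Φ₀ j w' w'<q) (occ+Φ≡j+Φ₀ j w w<q)
                      (Φ-antitone w'≤w w<q j) (Φ≤1+Φ w'≤w w<q w≤w'+b j)
                      (Φ-antitone w'≤w w<q 0) (Φ≤1+Φ w'≤w w<q w≤w'+b 0))

  interval-consistent : ∀ {lo hi} → 1 ≤ lo → hi ≤ q → hi ≤ lo + b → Consistent p q b (Interval lo hi)
  interval-consistent 1≤lo _ _ _ zero _ _ (lo≤0 , _) _ _ = contradiction (≤-trans 1≤lo lo≤0) (λ ())
  interval-consistent 1≤lo _ _ _ (suc _) zero _ _ (lo≤0 , _) _ = contradiction (≤-trans 1≤lo lo≤0) (λ ())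
  interval-consistent {lo} {hi} _ hi≤q hi≤lo+b j (suc w) (suc w') _ (lo≤x , x≤hi) (lo≤y , y≤hi) (_ , _ , two-apart) =
    contradiction (occ-within-one j (≤-trans x≤hi hi≤q) (≤-trans y≤hi hi≤q) (span lo≤x y≤hi) (span lo≤y x≤hi))
                  (m+2≰1+m two-apart)
    where
    span : ∀ {u v} → lo ≤ suc u → suc v ≤ hi → v ≤ u + b
    span lo≤u v<hi = ≤-pred (≤-trans v<hi (≤-trans hi≤lo+b (+-monoˡ-≤ b lo≤u)))
    m+2≰1+m : ∀ {m n} → n ≡ m + 2 → ¬ n ≤ suc m
    m+2≰1+m {m} refl le = <-irrefl refl (≤-trans (≤-reflexive (+-comm 2 m)) le)

lemma14 : (p q b : ℕ) → .{{_ : NonZero q}} → 1 ≤ p → p < q → q ≡ p + 2 * b → 2 * b ≤ p →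
    Consistent p q b (Interval (p + 1) (p + b)) × Consistent p q b (Interval (p + b + 1) q)
lemma14 p .(p + 2 * b) b _ _ refl _ =
    interval-consistent (m≤n+m 1 p) (+-monoʳ-≤ p (m≤m+n b (b + 0))) (+-monoˡ-≤ b (m≤m+n p 1))
  , interval-consistent (m≤n+m 1 (p + b)) ≤-refl (≤-trans (n≤1+n (p + 2 * b)) (≤-reflexive (one-more p b)))
  where
  open ControlSequence p b
  one-more : ∀ p b → suc (p + 2 * b) ≡ p + b + 1 + b
  one-more = solve-∀
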